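{- Let $n\geq 9$ and let $\rho_0,\ldots,\rho_{n-3}\in S_n$ be involutions whose permutation representation graph is of type (A) described in the context. Then $\langle\rho_0,\ldots,\rho_{n-3}\rangle=S_n$ and $(S_n,\{\rho_0,\ldots,\rho_{n-3}\})$ is a C-group of rank $n-2$.
   Context: A C-group of rank $r$ is a pair $(G,\{\rho_0,\ldots,\rho_{r-1}\})$ with $G$ generated by the involutions $\rho_i$ such that for all $J,K\subseteq\{0,\ldots,r-1\}$, $\langle\rho_j: j\in J\rangle\cap\langle\rho_k:k\in K\rangle=\langle\rho_j : j\in J\cap K\rangle$. The permutation representation graph has vertex set $\{1,\ldots,n\}$ and an $i$-edge $\{a,b\}$ whenever $a\rho_i=b\neq a$. Type (A): there is a tree $T$ with $n-3$ vertices in $\{1,\ldots,n\}$ whose $n-4$ edges are labelled bijectively by $2,\ldots,n-3$, $\rho_k$ ($k\geq2$) being the transposition of the endpoints of the $k$-edge; $t$ is a leaf of $T$ whose incident edge has label $2$; $a_1,a_2,a_3$ are the points not in $T$; and $\rho_0=(a_2\,a_3)$, $\rho_1=(a_1\,a_2)(a_3\,t)$. -}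

module Defs where

open import Data.Nat using (ℕ; _≤_; _∸_)
open import Data.Sum using (_⊎_)
open import Data.Fin using (Fin; toℕ)
open import Data.Fin.Subset using (Subset; _∈_)
open import Data.List using (List; []; _∷_)
open import Data.List.Relation.Unary.All using (All)
open import Data.Product using (Σ; _×_)
open import Function using (id; _∘_)
open import Relation.Binary.PropositionalEquality using (_≗_; _≡_; _≢_)
open import Data.Empty using (⊥)
open import Data.Fin.Permutation.Components using (transpose)

-- A map Fin n → Fin n (elements of S_n are represented by their action).
Fun : ℕ → Set
Fun n = Fin n → Fin n

swap : {n : ℕ} → Fin n → Fin n → Fun n
swap a b = transpose a b

eval : {r n : ℕ} → (Fin r → Fun n) → List (Fin r) → Fun n
eval ρ [] = id
eval ρ (i ∷ w) = eval ρ w ∘ ρ i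

-- f lies in the subgroup ⟨ρ_j : j ∈ J⟩.  In a finite permutation group
-- (generated by involutions) the generated subgroup is exactly the set of
-- products of generators.
InGen : {r n : ℕ} → (Fin r → Fun n) → Subset r → Fun n → Set
InGen ρ J f = Σ (List _) (λ w → All (λ i → i ∈ J) w × (eval ρ w ≗ f))

data Reach {r n : ℕ} (u v : Fin r → Fin n) (x : Fin n) : Fin n → Set where
  here : Reach u v x x
  fwd  : ∀ k → 2 ≤ toℕ k → Reach u v x (u k) → Reach u v x (v k)
  bwd  : ∀ k → 2 ≤ toℕ k → Reach u v x (v k) → Reach u v x (u k)

NotA : {n : ℕ} → Fin n → Fin n → Fin n → Fin n → Set
NotA a₁ a₂ a₃ x = (x ≢ a₁) × (x ≢ a₂) × (x ≢ a₃)

-- The tree T has vertex set {x | x ∉ {a₁,a₂,a₃}} (n-3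
-- vertices, as a₁,a₂,a₃ are distinct) and, for each label k ∈ {2,…,n-3},
-- the k-edge {u k, v k}.  A connected graph on n-3 vertices with n-4
-- edges is a tree.
record TypeA (n : ℕ) (ρ : Fin (n ∸ 2) → Fun n) : Set where
  field
    a₁ a₂ a₃ t : Fin n
    u v : Fin (n ∸ 2) → Fin n
    a₁≢a₂ : a₁ ≢ a₂
    a₁≢a₃ : a₁ ≢ a₃
    a₂≢a₃ : a₂ ≢ a₃
    u≢v   : ∀ k → 2 ≤ toℕ k → u k ≢ v k
    u∈T   : ∀ k → 2 ≤ toℕ k → NotA a₁ a₂ a₃ (u k)
    v∈T   : ∀ k → 2 ≤ toℕ k → NotA a₁ a₂ a₃ (v k)
    conn  : ∀ x y → NotA a₁ a₂ a₃ x → NotA a₁ a₂ a₃ y → Reach u v x y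
    -- t is a leaf of T whose incident edge has label 2
    t-on2 : ∀ k → toℕ k ≡ 2 → (t ≡ u k) ⊎ (t ≡ v k)
    t-leaf : ∀ k → 2 ≤ toℕ k → toℕ k ≢ 2 → (t ≢ u k) × (t ≢ v k)
    ρ-edge : ∀ k → 2 ≤ toℕ k → ρ k ≗ swap (u k) (v k)
    ρ₀ : ∀ k → toℕ k ≡ 0 → ρ k ≗ swap a₂ a₃
    ρ₁ : ∀ k → toℕ k ≡ 1 → ρ k ≗ (swap a₁ a₂ ∘ swap a₃ t)

-- Adjoin to the tree T the path a₁ – a₂ – a₃ – t.  The result 𝒯 is a connected
-- graph on all n points with n-1 edges, hence a tree (a counting argument).  Each
-- edge of 𝒯 is owned by one generator: {a₂,a₃} by ρ₀, {a₁,a₂} and {a₃,t} by ρ₁, the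
-- k-edge of T by ρ_k.  For a set J of labels let 𝒯_J be the forest of J-owned edges.
--   (1) every element of ⟨ρ_J⟩ moves each point inside its 𝒯_J-component;
--   (2) if 1 ∈ J implies 2 ∈ J, every edge of 𝒯_J has its transposition in ⟨ρ_J⟩
--       (ρ₂ = (t x₂), and words in ρ₁, ρ₂ give (a₃ t) and (a₁ a₂)), so by sorting
--       along paths ⟨ρ_J⟩ contains every permutation preserving 𝒯_J-components;
--   (3) in a tree, points joined in 𝒯_J and in 𝒯_K are joined in 𝒯_{J∩K}.
-- Taking J = everything in (2) gives ⟨ρ⟩ = S_n.  For ⟨ρ_J⟩ ∩ ⟨ρ_K⟩ ⊆ ⟨ρ_{J∩K}⟩,
-- (1)-(3) settle every case except 1 ∈ J ∩ K, 2 ∉ J (up to symmetry).  There an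
-- element of ⟨ρ_J⟩ splits into a word in ρ₀, ρ₁, acting on Q = {a₁,a₂,a₃,t} as the
-- dihedral group of order 8, and a product of tree generators ρ_k (k ≥ 3) acting
-- off Q; each part is shown to lie in ⟨ρ_{J∩K}⟩ separately.
module Submission where

open import Defs
open import Data.Nat using (ℕ; zero; suc; pred; _≤_; _∸_; _+_; s≤s; z≤n)
open import Data.Nat.Properties using (≤-trans; 1+n≰n; +-suc; +-identityʳ)
open import Data.Bool using (Bool; true; false)
import Data.Bool as Bool
open import Data.Fin using (Fin; zero; suc; toℕ; _≟_; punchOut; #_)
open import Data.Fin.Properties using (any?; all?; injective⇒≤; punchOut-injective)
open import Data.Fin.Subset using (Subset; ⊤; _∩_; _∈_; _∉_; _⊆_)
open import Data.Fin.Subset.Properties using (_∈?_; ∈⊤; x∈p∩q⁺; p∩q⊆p; p∩q⊆q; ∩-comm)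
open import Data.Fin.Permutation using (Permutation′; _⟨$⟩ʳ_; _⟨$⟩ˡ_; inverseˡ)
open import Data.Product using (Σ; ∃; _×_; _,_; proj₁; proj₂)
open import Data.Sum as Sum using (_⊎_; inj₁; inj₂)
open import Data.List using (List; []; _∷_; _++_; length; lookup; allFin; concatMap)
open import Data.List.Relation.Unary.All as All using (All; []; _∷_)
open import Data.List.Relation.Unary.All.Properties using (++⁺; ¬Any⇒All¬)
open import Data.List.Relation.Unary.Any as Any using (here; there)
open import Data.List.Relation.Unary.Any.Properties using (lookup-index)
open import Data.List.Relation.Unary.AllPairs using ([]; _∷_)
open import Data.List.Relation.Unary.Unique.Propositional using (Unique)
open import Data.List.Membership.Propositional using () renaming (_∈_ to _∈ˡ_; _∉_ to _∉ˡ_)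
open import Data.List.Membership.Propositional.Properties using (∈-allFin; ∈-lookup)
open import Data.Unit using (tt) renaming (⊤ to Unit)
open import Data.Empty using (⊥-elim)
open import Function using (id; _∘_)
open import Function.Definitions using (Injective)
open import Relation.Binary.PropositionalEquality
open import Relation.Nullary using (¬_; Dec; yes; no)
open import Relation.Nullary.Decidable using (True; toWitness; _×-dec_; _⊎-dec_; _→-dec_; ¬?)

IsInjective : {A B : Set} → (A → B) → Set
IsInjective = Injective _≡_ _≡_

module _ {n : ℕ} where

  swap-a : (a b : Fin n) → swap a b a ≡ b
  swap-a a b with a ≟ a
  ... | yes _ = refl
  ... | no a≢a = ⊥-elim (a≢a refl)

  swap-b : (a b : Fin n) → swap a b b ≡ a
  swap-b a b with b ≟ a
  ... | yes b≡a = b≡a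
  ... | no _ with b ≟ b
  ...   | yes _ = refl
  ...   | no b≢b = ⊥-elim (b≢b refl)

  swap-other : (a b x : Fin n) → x ≢ a → x ≢ b → swap a b x ≡ x
  swap-other a b x x≢a x≢b with x ≟ a
  ... | yes x≡a = ⊥-elim (x≢a x≡a)
  ... | no _ with x ≟ b
  ...   | yes x≡b = ⊥-elim (x≢b x≡b)
  ...   | no _ = refl

  data SwapView (a b x : Fin n) : Set where
    at-a  : x ≡ a → swap a b x ≡ b → SwapView a b x
    at-b  : x ≡ b → x ≢ a → swap a b x ≡ a → SwapView a b x
    other : x ≢ a → x ≢ b → swap a b x ≡ x → SwapView a b x

  swapView : (a b x : Fin n) → SwapView a b x
  swapView a b x with x ≟ a
  ... | yes refl = at-a refl (swap-a a b)
  ... | no x≢a with x ≟ b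
  ...   | yes refl = at-b refl x≢a (swap-b a b)
  ...   | no x≢b = other x≢a x≢b (swap-other a b x x≢a x≢b)

  swap-comm : (a b x : Fin n) → swap a b x ≡ swap b a x
  swap-comm a b x with swapView a b x
  ... | at-a refl eq = trans eq (sym (swap-b b x))
  ... | at-b refl _ eq = trans eq (sym (swap-a x a))
  ... | other x≢a x≢b eq = trans eq (sym (swap-other b a x x≢b x≢a))

  swap-involutive : (a b x : Fin n) → swap a b (swap a b x) ≡ x
  swap-involutive a b x with swapView a b x
  ... | at-a refl eq = trans (cong (swap x b) eq) (swap-b x b)
  ... | at-b refl _ eq = trans (cong (swap a x) eq) (swap-a a x)
  ... | other _ _ eq = trans (cong (swap a b) eq) eq

  swap-injective : (a b : Fin n) → IsInjective (swap a b)
  swap-injective a b {x} {y} eq =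
    trans (sym (swap-involutive a b x)) (trans (cong (swap a b) eq) (swap-involutive a b y))

  swap-self : (a x : Fin n) → swap a a x ≡ x
  swap-self a x with swapView a a x
  ... | at-a refl eq = eq
  ... | at-b refl _ eq = eq
  ... | other _ _ eq = eq

-- A word of transpositions, applied from left to right.
Transpositions : ℕ → Set
Transpositions n = List (Fin n × Fin n)

⟦_⟧ : {n : ℕ} → Transpositions n → Fun n
⟦ [] ⟧ = id
⟦ (a , b) ∷ τs ⟧ = ⟦ τs ⟧ ∘ swap a b

⟦⟧-++ : {n : ℕ} (τs σs : Transpositions n) → ∀ y → ⟦ τs ++ σs ⟧ y ≡ ⟦ σs ⟧ (⟦ τs ⟧ y)
⟦⟧-++ [] σs y = refl
⟦⟧-++ ((a , b) ∷ τs) σs y = ⟦⟧-++ τs σs (swap a b y)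

relabel : {c n : ℕ} → (Fin c → Fin n) → Transpositions c → Transpositions n
relabel ι [] = []
relabel ι ((a , b) ∷ τs) = (ι a , ι b) ∷ relabel ι τs

decide-≗ : {c : ℕ} (f g : Fun c) → True (all? (λ z → f z ≟ g z)) → f ≗ g
decide-≗ f g ok = toWitness ok

lookup-injective : {n : ℕ} (xs : List (Fin n)) → Unique xs → IsInjective (lookup xs)
lookup-injective (x ∷ xs) (_ ∷ _) {zero} {zero} eq = refl
lookup-injective (x ∷ xs) (x∉xs ∷ _) {zero} {suc j} eq = ⊥-elim (All.lookup x∉xs (∈-lookup j) eq)
lookup-injective (x ∷ xs) (x∉xs ∷ _) {suc i} {zero} eq = ⊥-elim (All.lookup x∉xs (∈-lookup i) (sym eq))
lookup-injective (x ∷ xs) (_ ∷ u) {suc i} {suc j} eq = cong suc (lookup-injective xs u eq)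

-- Along an injection ι, a relabelled word acts on the image of ι as the original
-- word and fixes every other point.  Hence an identity between transposition words
-- on c points holds for any c distinct points of Fin n.
module Embedding {c n : ℕ} (ι : Fin c → Fin n) (ι-inj : IsInjective ι) where

  OutsideImage : Fin n → Set
  OutsideImage y = ∀ z → y ≢ ι z

  swap-image : (a b z : Fin c) → swap (ι a) (ι b) (ι z) ≡ ι (swap a b z)
  swap-image a b z with swapView a b z
  ... | at-a refl eq = trans (swap-a (ι z) (ι b)) (cong ι (sym eq))
  ... | at-b refl _ eq = trans (swap-b (ι a) (ι z)) (cong ι (sym eq))
  ... | other z≢a z≢b eq = trans (swap-other _ _ _ (z≢a ∘ ι-inj) (z≢b ∘ ι-inj)) (cong ι (sym eq))

  ⟦⟧-image : (τs : Transpositions c) (z : Fin c) → ⟦ relabel ι τs ⟧ (ι z) ≡ ι (⟦ τs ⟧ z)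
  ⟦⟧-image [] z = refl
  ⟦⟧-image ((a , b) ∷ τs) z =
    trans (cong ⟦ relabel ι τs ⟧ (swap-image a b z)) (⟦⟧-image τs (swap a b z))

  ⟦⟧-outside : (τs : Transpositions c) (y : Fin n) → OutsideImage y → ⟦ relabel ι τs ⟧ y ≡ y
  ⟦⟧-outside [] y out = refl
  ⟦⟧-outside ((a , b) ∷ τs) y out =
    trans (cong ⟦ relabel ι τs ⟧ (swap-other _ _ y (out a) (out b))) (⟦⟧-outside τs y out)

  transfer : (τs σs : Transpositions c) → ⟦ τs ⟧ ≗ ⟦ σs ⟧ → ⟦ relabel ι τs ⟧ ≗ ⟦ relabel ι σs ⟧
  transfer τs σs eq y with any? (λ z → y ≟ ι z)
  ... | yes (z , refl) = trans (⟦⟧-image τs z) (trans (cong ι (eq z)) (sym (⟦⟧-image σs z)))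
  ... | no y∉ι = trans (⟦⟧-outside τs y out) (sym (⟦⟧-outside σs y out))
    where
    out : OutsideImage y
    out z y≡ιz = y∉ι (z , y≡ιz)

swap-conjugate : {n : ℕ} (x y z : Fin n) → x ≢ y → x ≢ z → y ≢ z →
                 ∀ w → swap y z (swap x y (swap y z w)) ≡ swap x z w
swap-conjugate {n} x y z x≢y x≢z y≢z =
  transfer ((# 1 , # 2) ∷ (# 0 , # 1) ∷ (# 1 , # 2) ∷ []) ((# 0 , # 2) ∷ []) (decide-≗ _ _ _)
  where
  xyz : List (Fin n)
  xyz = x ∷ y ∷ z ∷ []
  open Embedding (lookup xyz) (lookup-injective xyz ((x≢y ∷ x≢z ∷ []) ∷ (y≢z ∷ []) ∷ [] ∷ []))

module Generated {r n : ℕ} (ρ : Fin r → Fun n) where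

  eval-++ : (w₁ w₂ : List (Fin r)) → ∀ x → eval ρ (w₁ ++ w₂) x ≡ eval ρ w₂ (eval ρ w₁ x)
  eval-++ [] w₂ x = refl
  eval-++ (i ∷ w₁) w₂ x = eval-++ w₁ w₂ (ρ i x)

  inGen-id : ∀ J → InGen ρ J id
  inGen-id J = [] , [] , λ _ → refl

  inGen-resp : ∀ {J f g} → InGen ρ J f → f ≗ g → InGen ρ J g
  inGen-resp (w , w∈J , w≗f) f≗g = w , w∈J , λ x → trans (w≗f x) (f≗g x)

  inGen-∘ : ∀ {J f g} → InGen ρ J f → InGen ρ J g → InGen ρ J (g ∘ f)
  inGen-∘ {g = g} (w₁ , w₁∈J , w₁≗f) (w₂ , w₂∈J , w₂≗g) =
    w₁ ++ w₂ , ++⁺ w₁∈J w₂∈J ,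
    λ x → trans (eval-++ w₁ w₂ x) (trans (w₂≗g _) (cong g (w₁≗f x)))

  inGen-mono : ∀ {J K f} → J ⊆ K → InGen ρ J f → InGen ρ K f
  inGen-mono J⊆K (w , w∈J , w≗f) = w , All.map J⊆K w∈J , w≗f

  inGen-gen : ∀ {J} i → i ∈ J → InGen ρ J (ρ i)
  inGen-gen i i∈J = i ∷ [] , i∈J ∷ [] , λ _ → refl

  eval-injective : (∀ i → IsInjective (ρ i)) → ∀ w → IsInjective (eval ρ w)
  eval-injective ρ-inj [] eq = eq
  eval-injective ρ-inj (i ∷ w) eq = ρ-inj i (eval-injective ρ-inj w eq)

  eval-⟦⟧ : (E : Fin r → Transpositions n) (w : List (Fin r)) →
            All (λ i → ρ i ≗ ⟦ E i ⟧) w → eval ρ w ≗ ⟦ concatMap E w ⟧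
  eval-⟦⟧ E [] [] y = refl
  eval-⟦⟧ E (i ∷ w) (ρi≗ ∷ w≗) y =
    trans (eval-⟦⟧ E w w≗ (ρ i y))
          (trans (cong ⟦ concatMap E w ⟧ (ρi≗ y)) (sym (⟦⟧-++ (E i) (concatMap E w) y)))

avoiding-bound : {k : ℕ} (e₀ : Fin k) (F : List (Fin k)) → Unique F →
                 All (λ f → f ≢ e₀) F → suc (length F) ≤ k
avoiding-bound {suc k} e₀ F distinct avoids = s≤s (injective⇒≤ {f = squeeze} squeeze-inj)
  where
  e₀≢ : ∀ i → e₀ ≢ lookup F i
  e₀≢ i eq = All.lookup avoids (∈-lookup i) (sym eq)
  squeeze : Fin (length F) → Fin k
  squeeze i = punchOut (e₀≢ i)
  squeeze-inj : IsInjective squeeze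
  squeeze-inj eq = lookup-injective F distinct (punchOut-injective (e₀≢ _) (e₀≢ _) eq)

covering-bound : {n : ℕ} (R : List (Fin n)) → (∀ y → y ∈ˡ R) → n ≤ length R
covering-bound {n} R covers = injective⇒≤ {f = position} position-inj
  where
  position : Fin n → Fin (length R)
  position y = Any.index (covers y)
  position-inj : IsInjective position
  position-inj {x} {y} eq =
    trans (lookup-index (covers x)) (trans (cong (lookup R) eq) (sym (lookup-index (covers y))))

-- Graphs on Fin n whose edges are labelled by Fin k; edge e joins P e and Q e.

module Graph {n k : ℕ} (P Q : Fin k → Fin n) where

  Ends : Fin k → Fin n → Fin n → Set
  Ends e y z = (y ≡ P e × z ≡ Q e) ⊎ (y ≡ Q e × z ≡ P e)

  ends-sym : ∀ {e y z} → Ends e y z → Ends e z y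
  ends-sym (inj₁ (y≡ , z≡)) = inj₂ (z≡ , y≡)
  ends-sym (inj₂ (y≡ , z≡)) = inj₁ (z≡ , y≡)

  data Walk (S : Fin k → Set) (x : Fin n) : Fin n → Set where
    stay : Walk S x x
    step : ∀ {y z} e → S e → Ends e y z → Walk S x y → Walk S x z

  module _ {S : Fin k → Set} where

    edge-walk : ∀ {y z} e → S e → Ends e y z → Walk S y z
    edge-walk e s ends = step e s ends stay

    walk-trans : ∀ {x y z} → Walk S x y → Walk S y z → Walk S x z
    walk-trans p stay = p
    walk-trans p (step e s ends q) = step e s ends (walk-trans p q)

    walk-sym : ∀ {x y} → Walk S x y → Walk S y x
    walk-sym stay = stay
    walk-sym (step e s ends q) = walk-trans (edge-walk e s (ends-sym ends)) (walk-sym q)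

  swap-along : ∀ {S} e → S e → ∀ x → Walk S x (swap (P e) (Q e) x)
  swap-along {S} e s x with swapView (P e) (Q e) x
  ... | at-a refl eq = subst (Walk S x) (sym eq) (edge-walk e s (inj₁ (refl , refl)))
  ... | at-b refl _ eq = subst (Walk S x) (sym eq) (edge-walk e s (inj₂ (refl , refl)))
  ... | other _ _ eq = subst (Walk S x) (sym eq) stay

  walk-mono : ∀ {S S′ : Fin k → Set} → (∀ e → S e → S′ e) → ∀ {x y} → Walk S x y → Walk S′ x y
  walk-mono S⊆S′ stay = stay
  walk-mono S⊆S′ (step e s ends q) = step e (S⊆S′ e s) ends (walk-mono S⊆S′ q)

  confine : ∀ {S S′ : Fin k → Set} (X : Fin n → Set) →
            (∀ {e y z} → S e → Ends e y z → X y → S′ e × X z) →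
            ∀ {x y} → X x → Walk S x y → Walk S′ x y × X y
  confine X close x∈X stay = stay , x∈X
  confine X close x∈X (step e s ends q) with confine X close x∈X q
  ... | q′ , y∈X with close s ends y∈X
  ...   | s′ , z∈X = step e s′ ends q′ , z∈X

  -- We grow a tree from r, adding one vertex
  -- and one S-edge at a time, until no S-edge leaves the explored vertices.
  module Spanning (S : Fin k → Set) (S? : ∀ e → Dec (S e)) (e₀ : Fin k) (e₀∉S : ¬ S e₀)
                  (r : Fin n) (reach : ∀ y → Walk S r y) where
    open import Data.List.Membership.DecPropositional (_≟_ {n}) using () renaming (_∈?_ to _∈ˡ?_)

    record Explored : Set where
      field
        vertices : List (Fin n)
        edges    : List (Fin k)
        size     : length vertices ≡ suc (length edges)
        root     : r ∈ˡ vertices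
        distinct : Unique edges
        inS      : All S edges
        spanned  : All (λ f → P f ∈ˡ vertices × Q f ∈ˡ vertices) edges
    open Explored

    Leaves : List (Fin n) → Fin k → Set
    Leaves R f = (P f ∈ˡ R × Q f ∉ˡ R) ⊎ (Q f ∈ˡ R × P f ∉ˡ R)

    leaves? : ∀ R f → Dec (S f × Leaves R f)
    leaves? R f = S? f ×-dec (((P f ∈ˡ? R) ×-dec ¬? (Q f ∈ˡ? R)) ⊎-dec ((Q f ∈ˡ? R) ×-dec ¬? (P f ∈ˡ? R)))

    closed⇒reached : ∀ R → r ∈ˡ R → (∀ f → S f → ¬ Leaves R f) → ∀ y → Walk S r y → y ∈ˡ R
    closed⇒reached R r∈R closed y stay = r∈R
    closed⇒reached R r∈R closed z (step {y} e s ends q) with z ∈ˡ? R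
    ... | yes z∈R = z∈R
    ... | no z∉R with closed⇒reached R r∈R closed y q | ends
    ...   | y∈R | inj₁ (refl , refl) = ⊥-elim (closed e s (inj₁ (y∈R , z∉R)))
    ...   | y∈R | inj₂ (refl , refl) = ⊥-elim (closed e s (inj₂ (y∈R , z∉R)))

    -- The S-edges used so far miss e₀, so there are fewer than k of them.
    edges-bound : (s : Explored) → suc (length (edges s)) ≤ k
    edges-bound s = avoiding-bound e₀ (edges s) (distinct s) (All.map (λ sf f≡e₀ → e₀∉S (subst S f≡e₀ sf)) (inS s))

    cross : (s : Explored) → ∀ f → Leaves (vertices s) f →
            Σ (Fin n) λ w → P f ∈ˡ (w ∷ vertices s) × Q f ∈ˡ (w ∷ vertices s) × f ∉ˡ edges s
    cross s f (inj₁ (P∈ , Q∉)) = Q f , there P∈ , here refl , λ f∈ → Q∉ (proj₂ (All.lookup (spanned s) f∈))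
    cross s f (inj₂ (Q∈ , P∉)) = P f , here refl , there Q∈ , λ f∈ → P∉ (proj₁ (All.lookup (spanned s) f∈))

    add : (s : Explored) → ∀ f → S f → (w : Fin n) →
          P f ∈ˡ (w ∷ vertices s) → Q f ∈ˡ (w ∷ vertices s) → f ∉ˡ edges s → Explored
    add s f sf w P∈ Q∈ new = record
      { vertices = w ∷ vertices s ; edges = f ∷ edges s ; size = cong suc (size s)
      ; root = there (root s) ; distinct = ¬Any⇒All¬ (edges s) new ∷ distinct s
      ; inS = sf ∷ inS s
      ; spanned = (P∈ , Q∈) ∷ All.map (λ { (P∈′ , Q∈′) → there P∈′ , there Q∈′ }) (spanned s) }

    -- The fuel counts the labels that edges-bound still allows us to use.
    grow : (fuel : ℕ) (s : Explored) → suc (length (edges s)) + fuel ≡ k → n ≤ k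
    grow fuel s eq with any? (leaves? (vertices s))
    ... | no stuck = ≤-trans (covering-bound (vertices s) all-reached)
                             (subst (_≤ k) (sym (size s)) (edges-bound s))
      where
      all-reached : ∀ y → y ∈ˡ vertices s
      all-reached y = closed⇒reached (vertices s) (root s) (λ f sf l → stuck (f , sf , l)) y (reach y)
    grow fuel s eq | yes (f , sf , l) with cross s f l
    grow zero s eq | yes (f , sf , l) | w , P∈ , Q∈ , new =
      ⊥-elim (1+n≰n (subst (suc (suc L) ≤_) (trans (sym eq) (+-identityʳ (suc L))) (edges-bound (add s f sf w P∈ Q∈ new))))
      where
      L : ℕ
      L = length (edges s)
    grow (suc fuel) s eq | yes (f , sf , l) | w , P∈ , Q∈ , new =
      grow fuel (add s f sf w P∈ Q∈ new) (trans (sym (+-suc _ fuel)) eq)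

    bound : n ≤ k
    bound = grow _ start (suc-pred e₀)
      where
      start : Explored
      start = record { vertices = r ∷ [] ; edges = [] ; size = refl ; root = here refl
                     ; distinct = [] ; inS = [] ; spanned = [] }
      suc-pred : ∀ {k} → Fin k → suc (pred k) ≡ k
      suc-pred {suc k} _ = refl

  Avoiding : Fin k → Fin k → Set
  Avoiding e f = f ≢ e

  Acyclic : Set
  Acyclic = ∀ e → ¬ Walk (Avoiding e) (P e) (Q e)

  bypass : ∀ e → Walk (Avoiding e) (P e) (Q e) → ∀ {S : Fin k → Set} {x y} → Walk S x y → Walk (Avoiding e) x y
  bypass e detour stay = stay
  bypass e detour (step f s ends q) with f ≟ e
  ... | no f≢e = step f f≢e ends (bypass e detour q)
  bypass e detour (step f s (inj₁ (refl , refl)) q) | yes refl = walk-trans (bypass e detour q) detour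
  bypass e detour (step f s (inj₂ (refl , refl)) q) | yes refl = walk-trans (bypass e detour q) (walk-sym detour)

  acyclic-from : ∀ {S : Fin k → Set} → (∀ x y → Walk S x y) → ¬ (n ≤ k) → Acyclic
  acyclic-from connected n≰k e detour =
    n≰k (Spanning.bound (Avoiding e) (λ f → ¬? (f ≟ e)) e (λ e≢e → e≢e refl) (P e)
                         (λ y → bypass e detour (connected (P e) y)))

  module Tree (acyclic : Acyclic) where

    module _ {S T : Fin k → Set} (e : Fin k) (e∉T : ¬ T e) {x : Fin n} where

      S-e : Fin k → Set
      S-e f = S f × f ≢ e

      Crossing : Fin n → Set
      Crossing z = Walk S-e x z
                 ⊎ (Walk S-e x (P e) × Walk S-e (Q e) z)
                 ⊎ (Walk S-e x (Q e) × Walk S-e (P e) z)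

      avoiding : ∀ {a b} → Walk S-e a b → Walk (Avoiding e) a b
      avoiding = walk-mono (λ f → proj₂)

      avoidingT : ∀ {a b} → Walk T a b → Walk (Avoiding e) a b
      avoidingT = walk-mono (λ f tf f≡e → e∉T (subst T f≡e tf))

      crossing : ∀ {z} → Walk S x z → Crossing z
      crossing stay = inj₁ stay
      crossing (step f s ends q) with f ≟ e | crossing q
      ... | no f≢e | inj₁ p = inj₁ (step f (s , f≢e) ends p)
      ... | no f≢e | inj₂ (inj₁ (p₁ , p₂)) = inj₂ (inj₁ (p₁ , step f (s , f≢e) ends p₂))
      ... | no f≢e | inj₂ (inj₂ (p₁ , p₂)) = inj₂ (inj₂ (p₁ , step f (s , f≢e) ends p₂))
      crossing (step f s (inj₁ (refl , refl)) q) | yes refl | inj₁ p = inj₂ (inj₁ (p , stay))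
      crossing (step f s (inj₁ (refl , refl)) q) | yes refl | inj₂ (inj₁ (_ , p₂)) =
        ⊥-elim (acyclic e (walk-sym (avoiding p₂)))
      crossing (step f s (inj₁ (refl , refl)) q) | yes refl | inj₂ (inj₂ (p₁ , _)) = inj₁ p₁
      crossing (step f s (inj₂ (refl , refl)) q) | yes refl | inj₁ p = inj₂ (inj₂ (p , stay))
      crossing (step f s (inj₂ (refl , refl)) q) | yes refl | inj₂ (inj₁ (p₁ , _)) = inj₁ p₁
      crossing (step f s (inj₂ (refl , refl)) q) | yes refl | inj₂ (inj₂ (_ , p₂)) =
        ⊥-elim (acyclic e (avoiding p₂))

      -- If x, y are joined by S and by T, where e ∉ T, then they are joined by S - e:
      -- otherwise the S-walk crosses e and with the T-walk closes a cycle through e.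
      remove : ∀ {y} → Walk S x y → Walk T x y → Walk S-e x y
      remove p q with crossing p
      ... | inj₁ p′ = p′
      ... | inj₂ (inj₁ (p₁ , p₂)) =
        ⊥-elim (acyclic e (walk-trans (walk-sym (avoiding p₁)) (walk-trans (avoidingT q) (walk-sym (avoiding p₂)))))
      ... | inj₂ (inj₂ (p₁ , p₂)) =
        ⊥-elim (acyclic e (walk-trans (avoiding p₂) (walk-trans (walk-sym (avoidingT q)) (avoiding p₁))))

    -- Remove, one label at a time, the labels outside T from an S-walk.
    walk-∩ : ∀ {S T : Fin k → Set} → (∀ e → Dec (T e)) → ∀ {x y} →
             Walk S x y → Walk T x y → Walk (λ f → S f × T f) x y
    walk-∩ {S} {T} T? {x} {y} p q = walk-mono finish (prune (allFin k))
      where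
      -- S-labels that are in T or not yet examined
      Kept : List (Fin k) → Fin k → Set
      Kept L f = S f × (T f ⊎ f ∉ˡ L)
      examine : ∀ {L f e} → f ≢ e → f ∉ˡ L → f ∉ˡ (e ∷ L)
      examine f≢e f∉L (here f≡e) = f≢e f≡e
      examine f≢e f∉L (there f∈L) = f∉L f∈L
      prune : ∀ L → Walk (Kept L) x y
      prune [] = walk-mono (λ f s → s , inj₂ (λ ())) p
      prune (e ∷ L) with T? e
      ... | yes te = walk-mono keep (prune L)
        where
        keep : ∀ f → Kept L f → Kept (e ∷ L) f
        keep f (s , inj₁ tf) = s , inj₁ tf
        keep f (s , inj₂ f∉L) with f ≟ e
        ... | yes refl = s , inj₁ te
        ... | no f≢e = s , inj₂ (examine f≢e f∉L)
      ... | no e∉T = walk-mono keep (remove {S = Kept L} {T = T} e e∉T (prune L) q)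
        where
        keep : ∀ f → Kept L f × f ≢ e → Kept (e ∷ L) f
        keep f ((s , inj₁ tf) , _) = s , inj₁ tf
        keep f ((s , inj₂ f∉L) , f≢e) = s , inj₂ (examine f≢e f∉L)
      finish : ∀ f → Kept (allFin k) f → S f × T f
      finish f (s , inj₁ tf) = s , tf
      finish f (s , inj₂ f∉) = ⊥-elim (f∉ (∈-allFin f))

module Sorting {r n : ℕ} (ρ : Fin r → Fun n) (J : Subset r)
               (C : Fin n → Fin n → Set) (C-refl : ∀ {x} → C x x)
               (C-trans : ∀ {x y z} → C x y → C y z → C x z)
               (C-swap : ∀ {x y} → C x y → InGen ρ J (swap x y)) where
  open Generated ρ

  record Factorization (f : Fun n) (L : List (Fin n)) : Set where
    field
      g h    : Fun n
      factor : ∀ x → f x ≡ h (g x)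
      h∈J    : InGen ρ J h
      g-inj  : IsInjective g
      g-C    : ∀ x → C x (g x)
      g-fix  : ∀ y → y ∈ˡ L → g y ≡ y
  open Factorization

  -- Fix one more point x by moving the transposition (x  g x) from g over to h.
  fix-point : ∀ {f L} → Factorization f L → ∀ x → Factorization f (x ∷ L)
  fix-point {L = L} F x with g F x ≟ x
  ... | yes gx≡x = record
    { g = g F ; h = h F ; factor = factor F ; h∈J = h∈J F ; g-inj = g-inj F ; g-C = g-C F
    ; g-fix = λ { y (here refl) → gx≡x ; y (there y∈L) → g-fix F y y∈L } }
  ... | no gx≢x = record
    { g = τ ∘ G ; h = H ∘ τ
    ; factor = λ y → trans (factor F y) (cong H (sym (swap-involutive x (G x) (G y))))
    ; h∈J = inGen-∘ (C-swap (g-C F x)) (h∈J F)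
    ; g-inj = λ eq → g-inj F (swap-injective x (G x) eq)
    ; g-C = τG-C
    ; g-fix = τG-fix }
    where
    G H τ : Fun n
    G = g F
    H = h F
    τ = swap x (G x)
    τG-C : ∀ y → C y (τ (G y))
    τG-C y with swapView x (G x) (G y)
    ... | at-a Gy≡x τGy≡Gx = subst (C y) (sym τGy≡Gx) (C-trans (subst (C y) Gy≡x (g-C F y)) (g-C F x))
    ... | at-b Gy≡Gx _ τGy≡x with g-inj F Gy≡Gx
    ...   | refl = subst (C y) (sym τGy≡x) C-refl
    τG-C y | other _ _ τGy≡Gy = subst (C y) (sym τGy≡Gy) (g-C F y)
    τG-fix : ∀ y → y ∈ˡ (x ∷ L) → τ (G y) ≡ y
    τG-fix y (here refl) = swap-b x (G x)
    τG-fix y (there y∈L) = trans (cong τ Gy≡y) (swap-other x (G x) y y≢x y≢Gx)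
      where
      Gy≡y : G y ≡ y
      Gy≡y = g-fix F y y∈L
      y≢x : y ≢ x
      y≢x refl = gx≢x Gy≡y
      y≢Gx : y ≢ G x
      y≢Gx y≡Gx = y≢x (g-inj F (trans Gy≡y y≡Gx))

  factorize : ∀ f → IsInjective f → (∀ x → C x (f x)) → ∀ L → Factorization f L
  factorize f f-inj f-C [] = record
    { g = f ; h = id ; factor = λ _ → refl ; h∈J = inGen-id J
    ; g-inj = f-inj ; g-C = f-C ; g-fix = λ _ () }
  factorize f f-inj f-C (x ∷ L) = fix-point (factorize f f-inj f-C L) x

  inGen-by-transpositions : ∀ f → IsInjective f → (∀ x → C x (f x)) → InGen ρ J f
  inGen-by-transpositions f f-inj f-C =
    inGen-resp (h∈J F) (λ x → sym (trans (factor F x) (cong (h F) (g-fix F x (∈-allFin x)))))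
    where
    F : Factorization f (allFin n)
    F = factorize f f-inj f-C (allFin n)

module Componentwise {r n k : ℕ} (ρ : Fin r → Fun n) (J : Subset r) (P Q : Fin k → Fin n)
                     (S : Fin k → Set) (edge-swap : ∀ e → S e → InGen ρ J (swap (P e) (Q e))) where
  open Graph P Q
  open Generated ρ

  ends-swap : ∀ {e y z} → S e → Ends e y z → InGen ρ J (swap y z)
  ends-swap {e} s (inj₁ (refl , refl)) = edge-swap e s
  ends-swap {e} s (inj₂ (refl , refl)) = inGen-resp (edge-swap e s) (swap-comm (P e) (Q e))

  -- The transposition of the ends of a walk is a conjugate of edge transpositions.
  walk-swap : ∀ {x y} → Walk S x y → InGen ρ J (swap x y)
  walk-swap {x} stay = inGen-resp (inGen-id J) (λ w → sym (swap-self x w))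
  walk-swap {x} (step {y} {z} e s ends q) with x ≟ z | x ≟ y | y ≟ z
  ... | yes refl | _ | _ = inGen-resp (inGen-id J) (λ w → sym (swap-self x w))
  ... | no _ | yes refl | _ = ends-swap s ends
  ... | no _ | no _ | yes refl = walk-swap q
  ... | no x≢z | no x≢y | no y≢z =
    inGen-resp (inGen-∘ (ends-swap s ends) (inGen-∘ (walk-swap q) (ends-swap s ends)))
               (swap-conjugate x y z x≢y x≢z y≢z)

  componentwise : ∀ f → IsInjective f → (∀ x → Walk S x (f x)) → InGen ρ J f
  componentwise = Sorting.inGen-by-transpositions ρ J (Walk S) stay walk-trans walk-swap

-- The dihedral group of order 8 generated by s₀ = (1 2) and s₁ = (0 1)(2 3) on
-- Fin 4: its elements are tabulated and the needed facts checked by evaluation.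

module Dihedral where
  open import Data.Vec using (Vec; _∷_; []) renaming (lookup to at)

  σ₀ σ₁ : Transpositions 4
  σ₀ = (# 1 , # 2) ∷ []
  σ₁ = (# 2 , # 3) ∷ (# 0 , # 1) ∷ []

  s₀ s₁ : Fun 4
  s₀ = ⟦ σ₀ ⟧
  s₁ = ⟦ σ₁ ⟧

  -- the images of 0, 1, 2, 3 under each of the eight elements
  elements : Vec (Vec (Fin 4) 4) 8
  elements = (# 0 ∷ # 1 ∷ # 2 ∷ # 3 ∷ []) ∷ (# 0 ∷ # 2 ∷ # 1 ∷ # 3 ∷ []) ∷
             (# 1 ∷ # 0 ∷ # 3 ∷ # 2 ∷ []) ∷ (# 2 ∷ # 0 ∷ # 3 ∷ # 1 ∷ []) ∷
             (# 1 ∷ # 3 ∷ # 0 ∷ # 2 ∷ []) ∷ (# 2 ∷ # 3 ∷ # 0 ∷ # 1 ∷ []) ∷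
             (# 3 ∷ # 1 ∷ # 2 ∷ # 0 ∷ []) ∷ (# 3 ∷ # 2 ∷ # 1 ∷ # 0 ∷ []) ∷ []

  act : Fin 8 → Fun 4
  act c q = at (at elements c) q

  -- right multiplication by s₀ and by s₁, on indices
  times₀ times₁ : Fin 8 → Fin 8
  times₀ c = at (# 1 ∷ # 0 ∷ # 4 ∷ # 5 ∷ # 2 ∷ # 3 ∷ # 7 ∷ # 6 ∷ []) c
  times₁ c = at (# 2 ∷ # 3 ∷ # 0 ∷ # 1 ∷ # 6 ∷ # 7 ∷ # 4 ∷ # 5 ∷ []) c

  act-identity : ∀ q → act (# 0) q ≡ q
  act-identity = toWitness {a? = all? (λ q → act (# 0) q ≟ q)} _

  act-times₀ : ∀ c q → act (times₀ c) q ≡ act c (s₀ q)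
  act-times₀ = toWitness {a? = all? (λ c → all? (λ q → act (times₀ c) q ≟ act c (s₀ q)))} _

  act-times₁ : ∀ c q → act (times₁ c) q ≡ act c (s₁ q)
  act-times₁ = toWitness {a? = all? (λ c → all? (λ q → act (times₁ c) q ≟ act c (s₁ q)))} _

  half : Fin 4 → Bool
  half zero = true
  half (suc zero) = true
  half _ = false

  halves-kept : ∀ c → half (act c (# 0)) ≡ true → half (act c (# 2)) ≡ false →
                (∀ q → act c q ≡ q) ⊎ (∀ q → act c q ≡ s₁ q)
  halves-kept = toWitness {a? = all? (λ c → (half (act c (# 0)) Bool.≟ true) →-dec
                                           (half (act c (# 2)) Bool.≟ false) →-dec
                                           (all? (λ q → act c q ≟ q) ⊎-dec all? (λ q → act c q ≟ s₁ q)))} _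

module TypeAProof {m : ℕ} (ρ : Fin (3 + m) → Fun (5 + m)) (A : TypeA (5 + m) ρ) where
  open TypeA A
  open Generated ρ
  open Dihedral

  N : ℕ
  N = 5 + m

  l0 l1 l2 : Fin (3 + m)
  l0 = zero
  l1 = suc zero
  l2 = suc (suc zero)

  large : Fin m → Fin (3 + m)
  large j = suc (suc (suc j))

  2≤ : ∀ j → 2 ≤ toℕ {3 + m} (suc (suc j))
  2≤ j = s≤s (s≤s z≤n)

  P Q : Fin (4 + m) → Fin N
  P zero = a₃
  P (suc zero) = a₂
  P (suc (suc zero)) = a₁
  P (suc (suc (suc j))) = u (suc (suc j))
  Q zero = t
  Q (suc zero) = a₃
  Q (suc (suc zero)) = a₂
  Q (suc (suc (suc j))) = v (suc (suc j))

  owner : Fin (4 + m) → Fin (3 + m)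
  owner zero = l1
  owner (suc k) = k

  Owned : Subset (3 + m) → Fin (4 + m) → Set
  Owned J e = owner e ∈ J

  Owned? : ∀ J e → Dec (Owned J e)
  Owned? J e = owner e ∈? J

  open Graph P Q

  AllEdges : Fin (4 + m) → Set
  AllEdges _ = Unit

  -- t is a vertex of T, being an end of the 2-edge
  t∈T : NotA a₁ a₂ a₃ t
  t∈T with t-on2 l2 refl
  ... | inj₁ t≡u = subst (NotA a₁ a₂ a₃) (sym t≡u) (u∈T l2 (2≤ zero))
  ... | inj₂ t≡v = subst (NotA a₁ a₂ a₃) (sym t≡v) (v∈T l2 (2≤ zero))

  -- 𝒯 is connected: T is, and the path joins a₁, a₂, a₃ to t ∈ T.
  fromReach : ∀ {x y} → Reach u v x y → Walk AllEdges x y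
  fromReach here = stay
  fromReach (fwd zero () _)
  fromReach (fwd (suc zero) (s≤s ()) _)
  fromReach (bwd zero () _)
  fromReach (bwd (suc zero) (s≤s ()) _)
  fromReach (fwd (suc (suc j)) _ p) = step (suc (suc (suc j))) tt (inj₁ (refl , refl)) (fromReach p)
  fromReach (bwd (suc (suc j)) _ p) = step (suc (suc (suc j))) tt (inj₂ (refl , refl)) (fromReach p)

  to-t : ∀ x → Walk AllEdges x t
  to-t x with x ≟ a₁ | x ≟ a₂ | x ≟ a₃
  ... | yes refl | _ | _ =
    step zero tt (inj₁ (refl , refl)) (step (suc zero) tt (inj₁ (refl , refl))
      (edge-walk (suc (suc zero)) tt (inj₁ (refl , refl))))
  ... | no _ | yes refl | _ =
    step zero tt (inj₁ (refl , refl)) (edge-walk (suc zero) tt (inj₁ (refl , refl)))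
  ... | no _ | no _ | yes refl = edge-walk zero tt (inj₁ (refl , refl))
  ... | no x≢a₁ | no x≢a₂ | no x≢a₃ = fromReach (conn x t (x≢a₁ , x≢a₂ , x≢a₃) t∈T)

  connected : ∀ x y → Walk AllEdges x y
  connected x y = walk-trans (to-t x) (walk-sym (to-t y))

  -- 𝒯 has n vertices and n - 1 edges.
  acyclic : Acyclic
  acyclic = acyclic-from connected 1+n≰n

  open Tree acyclic

  generator-along : ∀ J i → i ∈ J → ∀ x → Walk (Owned J) x (ρ i x)
  generator-along J zero i∈J x =
    subst (Walk (Owned J) x) (sym (ρ₀ zero refl x)) (swap-along (suc zero) i∈J x)
  generator-along J (suc zero) i∈J x =
    subst (Walk (Owned J) x) (sym (ρ₁ (suc zero) refl x))
          (walk-trans (swap-along zero i∈J x) (swap-along (suc (suc zero)) i∈J _))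
  generator-along J (suc (suc j)) i∈J x =
    subst (Walk (Owned J) x) (sym (ρ-edge (suc (suc j)) (2≤ j) x)) (swap-along (suc (suc (suc j))) i∈J x)

  inGen-along : ∀ {J f} → InGen ρ J f → ∀ x → Walk (Owned J) x (f x)
  inGen-along {J} (w , w∈J , w≗f) x = subst (Walk (Owned J) x) (w≗f x) (word-along w w∈J x)
    where
    word-along : ∀ w → All (_∈ J) w → ∀ x → Walk (Owned J) x (eval ρ w x)
    word-along [] [] x = stay
    word-along (i ∷ w) (i∈J ∷ w∈J) x = walk-trans (generator-along J i i∈J x) (word-along w w∈J (ρ i x))

  moves-∩ : ∀ {J K f} → InGen ρ J f → InGen ρ K f → ∀ x → Walk (Owned (J ∩ K)) x (f x)
  moves-∩ {J} {K} f∈J f∈K x =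
    walk-mono (λ e → x∈p∩q⁺ {p = J} {q = K}) (walk-∩ (Owned? K) (inGen-along f∈J x) (inGen-along f∈K x))

  ρ-injective : ∀ i → IsInjective (ρ i)
  ρ-injective zero {x} {y} eq = swap-injective a₂ a₃ (trans (sym (ρ₀ zero refl x)) (trans eq (ρ₀ zero refl y)))
  ρ-injective (suc zero) {x} {y} eq =
    swap-injective a₃ t (swap-injective a₁ a₂ (trans (sym (ρ₁ (suc zero) refl x)) (trans eq (ρ₁ (suc zero) refl y))))
  ρ-injective (suc (suc j)) {x} {y} eq =
    swap-injective _ _ (trans (sym (ρ-edge (suc (suc j)) (2≤ j) x)) (trans eq (ρ-edge (suc (suc j)) (2≤ j) y)))

  inGen-injective : ∀ {J f} → InGen ρ J f → IsInjective f
  inGen-injective (w , _ , w≗f) {x} {y} eq = eval-injective ρ-injective w (trans (w≗f x) (trans eq (sym (w≗f y))))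

  record Neighbour : Set where
    field
      x₂      : Fin N
      ρ₂-swap : ρ l2 ≗ swap t x₂
      x₂≢t    : x₂ ≢ t
      x₂∈T    : NotA a₁ a₂ a₃ x₂

  neighbour : Neighbour
  neighbour with t-on2 l2 refl
  ... | inj₁ t≡u = record
    { x₂ = v l2
    ; ρ₂-swap = λ y → trans (ρ-edge l2 (2≤ zero) y) (cong (λ z → swap z (v l2) y) (sym t≡u))
    ; x₂≢t = λ v≡t → u≢v l2 (2≤ zero) (trans (sym t≡u) (sym v≡t))
    ; x₂∈T = v∈T l2 (2≤ zero) }
  ... | inj₂ t≡v = record
    { x₂ = u l2
    ; ρ₂-swap = λ y → trans (ρ-edge l2 (2≤ zero) y) (trans (swap-comm _ _ y) (cong (λ z → swap z (u l2) y) (sym t≡v)))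
    ; x₂≢t = λ u≡t → u≢v l2 (2≤ zero) (trans u≡t t≡v)
    ; x₂∈T = u∈T l2 (2≤ zero) }
  open Neighbour neighbour

  a₁≢ : ∀ {x} → NotA a₁ a₂ a₃ x → a₁ ≢ x
  a₁≢ (x≢a₁ , _ , _) = ≢-sym x≢a₁
  a₂≢ : ∀ {x} → NotA a₁ a₂ a₃ x → a₂ ≢ x
  a₂≢ (_ , x≢a₂ , _) = ≢-sym x≢a₂
  a₃≢ : ∀ {x} → NotA a₁ a₂ a₃ x → a₃ ≢ x
  a₃≢ (_ , _ , x≢a₃) = ≢-sym x≢a₃

  -- On the five points a₁ a₂ a₃ t x₂ (numbered 0 to 4)
  -- ρ₁ = (0 1)(2 3) and ρ₂ = (3 4); the words ρ₂ρ₁ρ₂ρ₁ρ₂ and ρ₂ρ₁ρ₂ρ₁ρ₂ρ₁ act as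
  -- (2 3) = (a₃ t) and (0 1) = (a₁ a₂).
  five : List (Fin N)
  five = a₁ ∷ a₂ ∷ a₃ ∷ t ∷ x₂ ∷ []

  module OnFive = Embedding (lookup five) (lookup-injective five
    ((a₁≢a₂ ∷ a₁≢a₃ ∷ a₁≢ t∈T ∷ a₁≢ x₂∈T ∷ []) ∷ (a₂≢a₃ ∷ a₂≢ t∈T ∷ a₂≢ x₂∈T ∷ []) ∷
     (a₃≢ t∈T ∷ a₃≢ x₂∈T ∷ []) ∷ ((x₂≢t ∘ sym) ∷ []) ∷ [] ∷ []))

  -- ρ₁ and ρ₂ as transposition words on the five points
  ρ₁ρ₂-on-five : Fin (3 + m) → Transpositions 5
  ρ₁ρ₂-on-five (suc zero) = (# 2 , # 3) ∷ (# 0 , # 1) ∷ []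
  ρ₁ρ₂-on-five (suc (suc zero)) = (# 3 , # 4) ∷ []
  ρ₁ρ₂-on-five _ = []

  E : Fin (3 + m) → Transpositions N
  E = relabel (lookup five) ∘ ρ₁ρ₂-on-five

  ρ₁≗ : ρ l1 ≗ ⟦ E l1 ⟧
  ρ₁≗ = ρ₁ l1 refl

  ρ₂≗ : ρ l2 ≗ ⟦ E l2 ⟧
  ρ₂≗ = ρ₂-swap

  a₃t-word a₁a₂-word : List (Fin (3 + m))
  a₃t-word = l2 ∷ l1 ∷ l2 ∷ l1 ∷ l2 ∷ []
  a₁a₂-word = l2 ∷ l1 ∷ l2 ∷ l1 ∷ l2 ∷ l1 ∷ []

  swap-a₃t : eval ρ a₃t-word ≗ swap a₃ t
  swap-a₃t y = trans (eval-⟦⟧ E a₃t-word (ρ₂≗ ∷ ρ₁≗ ∷ ρ₂≗ ∷ ρ₁≗ ∷ ρ₂≗ ∷ []) y)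
                     (OnFive.transfer (concatMap ρ₁ρ₂-on-five a₃t-word) ((# 2 , # 3) ∷ []) (decide-≗ _ _ _) y)

  swap-a₁a₂ : eval ρ a₁a₂-word ≗ swap a₁ a₂
  swap-a₁a₂ y = trans (eval-⟦⟧ E a₁a₂-word (ρ₂≗ ∷ ρ₁≗ ∷ ρ₂≗ ∷ ρ₁≗ ∷ ρ₂≗ ∷ ρ₁≗ ∷ []) y)
                      (OnFive.transfer (concatMap ρ₁ρ₂-on-five a₁a₂-word) ((# 0 , # 1) ∷ []) (decide-≗ _ _ _) y)

  owned-swap : ∀ J → (l1 ∈ J → l2 ∈ J) → ∀ e → Owned J e → InGen ρ J (swap (P e) (Q e))
  owned-swap J l1⇒l2 zero l1∈J =
    a₃t-word , (l2∈J ∷ l1∈J ∷ l2∈J ∷ l1∈J ∷ l2∈J ∷ []) , swap-a₃t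
    where
    l2∈J : l2 ∈ J
    l2∈J = l1⇒l2 l1∈J
  owned-swap J l1⇒l2 (suc zero) l0∈J = inGen-resp (inGen-gen l0 l0∈J) (ρ₀ zero refl)
  owned-swap J l1⇒l2 (suc (suc zero)) l1∈J =
    a₁a₂-word , (l2∈J ∷ l1∈J ∷ l2∈J ∷ l1∈J ∷ l2∈J ∷ l1∈J ∷ []) , swap-a₁a₂
    where
    l2∈J : l2 ∈ J
    l2∈J = l1⇒l2 l1∈J
  owned-swap J l1⇒l2 (suc (suc (suc j))) k∈J =
    inGen-resp (inGen-gen (suc (suc j)) k∈J) (ρ-edge (suc (suc j)) (2≤ j))

  by-components : ∀ J → (l1 ∈ J → l2 ∈ J) → ∀ f → IsInjective f →
                  (∀ x → Walk (Owned J) x (f x)) → InGen ρ J f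
  by-components J l1⇒l2 = Componentwise.componentwise ρ J P Q (Owned J) (owned-swap J l1⇒l2)

  generates : (π : Permutation′ N) → InGen ρ ⊤ (π ⟨$⟩ʳ_)
  generates π = by-components ⊤ (λ _ → ∈⊤) (π ⟨$⟩ʳ_) π-inj (λ x → walk-mono (λ _ _ → ∈⊤) (connected x _))
    where
    π-inj : IsInjective (π ⟨$⟩ʳ_)
    π-inj {x} {y} eq = trans (sym (inverseˡ π)) (trans (cong (π ⟨$⟩ˡ_) eq) (inverseˡ π))

  ι : Fin 4 → Fin N
  ι = lookup (a₁ ∷ a₂ ∷ a₃ ∷ t ∷ [])

  ι-inj : IsInjective ι
  ι-inj = lookup-injective _ ((a₁≢a₂ ∷ a₁≢a₃ ∷ a₁≢ t∈T ∷ []) ∷ (a₂≢a₃ ∷ a₂≢ t∈T ∷ []) ∷ (a₃≢ t∈T ∷ []) ∷ [] ∷ [])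

  module OnQ = Embedding ι ι-inj

  OffQ : Fin N → Set
  OffQ = OnQ.OutsideImage

  onQ? : ∀ y → Dec (∃ λ q → y ≡ ι q)
  onQ? y = any? (λ q → y ≟ ι q)

  offQ : ∀ {y} → NotA a₁ a₂ a₃ y → t ≢ y → OffQ y
  offQ (y≢a₁ , _ , _) _ zero = y≢a₁
  offQ (_ , y≢a₂ , _) _ (suc zero) = y≢a₂
  offQ (_ , _ , y≢a₃) _ (suc (suc zero)) = y≢a₃
  offQ _ t≢y (suc (suc (suc zero))) = t≢y ∘ sym

  -- The edges of T other than the 2-edge avoid Q, since t is a leaf.
  large-ends-offQ : ∀ j → OffQ (u (large j)) × OffQ (v (large j))
  large-ends-offQ j with t-leaf (large j) (2≤ (suc j)) (λ ())
  ... | t≢u , t≢v = offQ (u∈T (large j) (2≤ (suc j))) t≢u , offQ (v∈T (large j) (2≤ (suc j))) t≢v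

  Small : Fin (3 + m) → Set
  Small i = i ≡ l0 ⊎ i ≡ l1

  σ : ∀ {i} → Small i → Fun 4
  σ (inj₁ _) = s₀
  σ (inj₂ _) = s₁

  small-onQ : ∀ {i} (s : Small i) q → ρ i (ι q) ≡ ι (σ s q)
  small-onQ (inj₁ refl) q = trans (ρ₀ l0 refl (ι q)) (OnQ.⟦⟧-image σ₀ q)
  small-onQ (inj₂ refl) q = trans (ρ₁ l1 refl (ι q)) (OnQ.⟦⟧-image σ₁ q)

  small-offQ : ∀ {i} → Small i → ∀ {y} → OffQ y → ρ i y ≡ y
  small-offQ (inj₁ refl) {y} off = trans (ρ₀ l0 refl y) (OnQ.⟦⟧-outside σ₀ y off)
  small-offQ (inj₂ refl) {y} off = trans (ρ₁ l1 refl y) (OnQ.⟦⟧-outside σ₁ y off)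

  Large : Fin (3 + m) → Set
  Large i = ∃ λ j → i ≡ large j

  large-onQ : ∀ j q → ρ (large j) (ι q) ≡ ι q
  large-onQ j q = trans (ρ-edge (large j) (2≤ (suc j)) (ι q))
                        (swap-other _ _ _ (λ eq → proj₁ (large-ends-offQ j) q (sym eq))
                                          (λ eq → proj₂ (large-ends-offQ j) q (sym eq)))

  large-offQ : ∀ j {y} → OffQ y → OffQ (ρ (large j) y)
  large-offQ j {y} off rewrite ρ-edge (large j) (2≤ (suc j)) y with swapView (u (large j)) (v (large j)) y
  ... | at-a _ eq = subst OffQ (sym eq) (proj₂ (large-ends-offQ j))
  ... | at-b _ _ eq = subst OffQ (sym eq) (proj₁ (large-ends-offQ j))
  ... | other _ _ eq = subst OffQ (sym eq) off

  -- Having disjoint supports, small and large generators commute.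
  commute : ∀ {i} → Small i → ∀ j x → ρ i (ρ (large j) x) ≡ ρ (large j) (ρ i x)
  commute s j x with onQ? x
  ... | yes (q , refl) = begin
    ρ _ (ρ (large j) (ι q)) ≡⟨ cong (ρ _) (large-onQ j q) ⟩
    ρ _ (ι q)               ≡⟨ small-onQ s q ⟩
    ι (σ s q)               ≡⟨ sym (large-onQ j (σ s q)) ⟩
    ρ (large j) (ι (σ s q)) ≡⟨ cong (ρ (large j)) (sym (small-onQ s q)) ⟩
    ρ (large j) (ρ _ (ι q)) ∎
    where open ≡-Reasoning
  ... | no x∉Q = trans (small-offQ s (large-offQ j off)) (cong (ρ (large j)) (sym (small-offQ s off)))
    where
    off : OffQ x
    off q x≡ = x∉Q (q , x≡)

  smallWord-offQ : ∀ {d} → All Small d → ∀ {y} → OffQ y → eval ρ d y ≡ y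
  smallWord-offQ [] off = refl
  smallWord-offQ {_ ∷ d} (s ∷ ss) off = trans (cong (eval ρ d) (small-offQ s off)) (smallWord-offQ ss off)

  smallWord-commute : ∀ {d} → All Small d → ∀ j x → eval ρ d (ρ (large j) x) ≡ ρ (large j) (eval ρ d x)
  smallWord-commute [] j x = refl
  smallWord-commute {_ ∷ d} (s ∷ ss) j x = trans (cong (eval ρ d) (commute s j x)) (smallWord-commute ss j _)

  largeWord-onQ : ∀ {b} → All Large b → ∀ q → eval ρ b (ι q) ≡ ι q
  largeWord-onQ [] q = refl
  largeWord-onQ {_ ∷ b} ((j , refl) ∷ ls) q = trans (cong (eval ρ b) (large-onQ j q)) (largeWord-onQ ls q)

  smallWord-onQ : ∀ {d} → All Small d → Σ (Fin 8) λ c → ∀ q → eval ρ d (ι q) ≡ ι (act c q)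
  smallWord-onQ [] = # 0 , λ q → cong ι (sym (act-identity q))
  smallWord-onQ {i ∷ d} (s ∷ ss) with smallWord-onQ ss
  ... | c , onQ = times s c , λ q →
    trans (cong (eval ρ d) (small-onQ s q)) (trans (onQ (σ s q)) (cong ι (sym (act-times s c q))))
    where
    times : ∀ {i} → Small i → Fin 8 → Fin 8
    times (inj₁ _) = times₀
    times (inj₂ _) = times₁
    act-times : ∀ {i} (s : Small i) c q → act (times s c) q ≡ act c (σ s q)
    act-times (inj₁ _) = act-times₀
    act-times (inj₂ _) = act-times₁

  smallWord-determined : ∀ {d d′} → All Small d → All Small d′ →
                         (∀ q → eval ρ d (ι q) ≡ eval ρ d′ (ι q)) → eval ρ d ≗ eval ρ d′
  smallWord-determined ss ss′ agree y with onQ? y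
  ... | yes (q , refl) = agree q
  ... | no y∉Q = trans (smallWord-offQ ss off) (sym (smallWord-offQ ss′ off))
    where
    off : OffQ y
    off q y≡ = y∉Q (q , y≡)

  record Separated (w : List (Fin (3 + m))) (J : Subset (3 + m)) : Set where
    field
      smallWord largeWord : List (Fin (3 + m))
      small∈J             : All (_∈ J) smallWord
      small-letters       : All Small smallWord
      large-letters       : All Large largeWord
      factor              : ∀ x → eval ρ w x ≡ eval ρ largeWord (eval ρ smallWord x)

  separate : ∀ J → l2 ∉ J → ∀ w → All (_∈ J) w → Separated w J
  separate J l2∉J [] [] = record
    { smallWord = [] ; largeWord = [] ; small∈J = [] ; small-letters = [] ; large-letters = [] ; factor = λ _ → refl }
  separate J l2∉J (i ∷ w) (i∈J ∷ w∈J) = extend i i∈J (separate J l2∉J w w∈J)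
    where
    open Separated
    with-small : ∀ {i} → Small i → i ∈ J → Separated w J → Separated (i ∷ w) J
    with-small s i∈J W = record
      { smallWord = _ ∷ smallWord W ; largeWord = largeWord W
      ; small∈J = i∈J ∷ small∈J W ; small-letters = s ∷ small-letters W ; large-letters = large-letters W
      ; factor = λ x → factor W (ρ _ x) }
    with-large : ∀ j → Separated w J → Separated (large j ∷ w) J
    with-large j W = record
      { smallWord = smallWord W ; largeWord = large j ∷ largeWord W
      ; small∈J = small∈J W ; small-letters = small-letters W ; large-letters = (j , refl) ∷ large-letters W
      ; factor = λ x → trans (factor W (ρ (large j) x))
                             (cong (eval ρ (largeWord W)) (smallWord-commute (small-letters W) j x)) }
    extend : ∀ i → i ∈ J → Separated w J → Separated (i ∷ w) J
    extend zero i∈J = with-small (inj₁ refl) i∈J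
    extend (suc zero) i∈J = with-small (inj₂ refl) i∈J
    extend (suc (suc zero)) i∈J = ⊥-elim (l2∉J i∈J)
    extend (suc (suc (suc j))) _ = with-large j

  LargeEdge : Fin (4 + m) → Set
  LargeEdge e = ∃ λ j → e ≡ suc (large j)

  offQ-walk : ∀ J → l2 ∉ J → ∀ {x y} → OffQ x → Walk (Owned J) x y →
              Walk (λ e → Owned J e × LargeEdge e) x y × OffQ y
  offQ-walk J l2∉J = confine OffQ close
    where
    close : ∀ {e y z} → Owned J e → Ends e y z → OffQ y → (Owned J e × LargeEdge e) × OffQ z
    close {zero} _ (inj₁ (refl , refl)) off = ⊥-elim (off (# 2) refl)
    close {zero} _ (inj₂ (refl , refl)) off = ⊥-elim (off (# 3) refl)
    close {suc zero} _ (inj₁ (refl , refl)) off = ⊥-elim (off (# 1) refl)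
    close {suc zero} _ (inj₂ (refl , refl)) off = ⊥-elim (off (# 2) refl)
    close {suc (suc zero)} _ (inj₁ (refl , refl)) off = ⊥-elim (off (# 0) refl)
    close {suc (suc zero)} _ (inj₂ (refl , refl)) off = ⊥-elim (off (# 1) refl)
    close {suc (suc (suc zero))} l2∈J _ _ = ⊥-elim (l2∉J l2∈J)
    close {suc (suc (suc (suc j)))} o (inj₁ (refl , refl)) _ = (o , j , refl) , proj₂ (large-ends-offQ j)
    close {suc (suc (suc (suc j)))} o (inj₂ (refl , refl)) _ = (o , j , refl) , proj₁ (large-ends-offQ j)

  InHalf : Bool → Fin N → Set
  InHalf h y = ∃ λ q → y ≡ ι q × half q ≡ h

  half-walk : ∀ J → l0 ∉ J → l2 ∉ J → ∀ q {y} → Walk (Owned J) (ι q) y → InHalf (half q) y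
  half-walk J l0∉J l2∉J q p = proj₂ (confine {S = Owned J} {S′ = Owned J} (InHalf (half q)) (λ {e} → close {e}) (q , refl , refl) p)
    where
    close : ∀ {e y z} → Owned J e → Ends e y z → InHalf (half q) y → Owned J e × InHalf (half q) z
    close {zero} o (inj₁ (refl , refl)) (p , eq , h) = o , # 3 , refl , trans (cong half (ι-inj {# 2} eq)) h
    close {zero} o (inj₂ (refl , refl)) (p , eq , h) = o , # 2 , refl , trans (cong half (ι-inj {# 3} eq)) h
    close {suc zero} l0∈J _ _ = ⊥-elim (l0∉J l0∈J)
    close {suc (suc zero)} o (inj₁ (refl , refl)) (p , eq , h) = o , # 1 , refl , trans (cong half (ι-inj {# 0} eq)) h
    close {suc (suc zero)} o (inj₂ (refl , refl)) (p , eq , h) = o , # 0 , refl , trans (cong half (ι-inj {# 1} eq)) h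
    close {suc (suc (suc zero))} l2∈J _ _ = ⊥-elim (l2∉J l2∈J)
    close {suc (suc (suc (suc j)))} o (inj₁ (refl , refl)) (p , eq , _) = ⊥-elim (proj₁ (large-ends-offQ j) p eq)
    close {suc (suc (suc (suc j)))} o (inj₂ (refl , refl)) (p , eq , _) = ⊥-elim (proj₂ (large-ends-offQ j) p eq)

  offQ-by-components : ∀ J → l2 ∉ J → ∀ g → IsInjective g → (∀ q → g (ι q) ≡ ι q) →
                       (∀ x → OffQ x → Walk (Owned J) x (g x)) → InGen ρ J g
  offQ-by-components J l2∉J g g-inj g-onQ g-offQ = componentwise g g-inj moves
    where
    OwnedLarge : Fin (4 + m) → Set
    OwnedLarge e = Owned J e × LargeEdge e
    large-swap : ∀ e → OwnedLarge e → InGen ρ J (swap (P e) (Q e))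
    large-swap _ (o , j , refl) = inGen-resp (inGen-gen (large j) o) (ρ-edge (large j) (2≤ (suc j)))
    open Componentwise ρ J P Q OwnedLarge large-swap
    moves : ∀ x → Walk OwnedLarge x (g x)
    moves x with onQ? x
    ... | yes (q , refl) = subst (Walk OwnedLarge (ι q)) (sym (g-onQ q)) stay
    ... | no x∉Q = proj₁ (offQ-walk J l2∉J off (g-offQ x off))
      where
      off : OffQ x
      off q x≡ = x∉Q (q , x≡)

  small-within-halves : ∀ J → l0 ∉ J → l2 ∉ J → ∀ {d} → All Small d →
                        (∀ q → Walk (Owned J) (ι q) (eval ρ d (ι q))) →
                        (eval ρ d ≗ id) ⊎ (eval ρ d ≗ ρ l1)
  small-within-halves J l0∉J l2∉J {d} ss moves =
    Sum.map (λ c≗id → smallWord-determined ss [] (λ q → trans (onQ q) (cong ι (c≗id q))))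
            (λ c≗s₁ → smallWord-determined ss (inj₂ refl ∷ [])
                        (λ q → trans (onQ q) (trans (cong ι (c≗s₁ q)) (sym (small-onQ (inj₂ refl) q)))))
            (halves-kept c (kept (# 0)) (kept (# 2)))
    where
    c : Fin 8
    c = proj₁ (smallWord-onQ ss)
    onQ : ∀ q → eval ρ d (ι q) ≡ ι (act c q)
    onQ = proj₂ (smallWord-onQ ss)
    kept : ∀ q → half (act c q) ≡ half q
    kept q with half-walk J l0∉J l2∉J q (moves q)
    ... | p , eq , h = trans (cong half (ι-inj (trans (sym (onQ q)) eq))) h

  dihedral-part : ∀ J K → l1 ∈ J → l1 ∈ K → l2 ∉ J → ∀ {d} → All (_∈ J) d → All Small d →
                  (∀ q → Walk (Owned (J ∩ K)) (ι q) (eval ρ d (ι q))) → InGen ρ (J ∩ K) (eval ρ d)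
  dihedral-part J K l1∈J l1∈K l2∉J {d} d∈J ss moves with l0 ∈? K
  ... | yes l0∈K = d , in-both d∈J ss , λ _ → refl
    where
    in-both : ∀ {d} → All (_∈ J) d → All Small d → All (_∈ J ∩ K) d
    in-both [] [] = []
    in-both (i∈J ∷ d∈J) (inj₁ refl ∷ ss) = x∈p∩q⁺ (i∈J , l0∈K) ∷ in-both d∈J ss
    in-both (i∈J ∷ d∈J) (inj₂ refl ∷ ss) = x∈p∩q⁺ (i∈J , l1∈K) ∷ in-both d∈J ss
  ... | no l0∉K with small-within-halves (J ∩ K) (l0∉K ∘ p∩q⊆q J K) (l2∉J ∘ p∩q⊆p J K) ss moves
  ...   | inj₁ d≗id = inGen-resp (inGen-id _) (λ x → sym (d≗id x))
  ...   | inj₂ d≗ρ₁ = inGen-resp (inGen-gen l1 (x∈p∩q⁺ (l1∈J , l1∈K))) (λ x → sym (d≗ρ₁ x))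

  special : ∀ J K → l1 ∈ J → l1 ∈ K → l2 ∉ J → ∀ f → InGen ρ J f →
            (∀ x → Walk (Owned (J ∩ K)) x (f x)) → InGen ρ (J ∩ K) f
  special J K l1∈J l1∈K l2∉J f (w , w∈J , w≗f) moves = inGen-resp (inGen-∘ small-part large-part) f≗
    where
    open Separated (separate J l2∉J w w∈J)
    f≗ : ∀ x → eval ρ largeWord (eval ρ smallWord x) ≡ f x
    f≗ x = trans (sym (factor x)) (w≗f x)
    f-onQ : ∀ q → f (ι q) ≡ eval ρ smallWord (ι q)
    f-onQ q with smallWord-onQ small-letters
    ... | c , onQ = begin
      f (ι q)                                            ≡⟨ sym (f≗ (ι q)) ⟩
      eval ρ largeWord (eval ρ smallWord (ι q))          ≡⟨ cong (eval ρ largeWord) (onQ q) ⟩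
      eval ρ largeWord (ι (act c q))                     ≡⟨ largeWord-onQ large-letters (act c q) ⟩
      ι (act c q)                                        ≡⟨ sym (onQ q) ⟩
      eval ρ smallWord (ι q)                             ∎
      where open ≡-Reasoning
    f-offQ : ∀ x → OffQ x → f x ≡ eval ρ largeWord x
    f-offQ x off = trans (sym (f≗ x)) (cong (eval ρ largeWord) (smallWord-offQ small-letters off))
    small-part : InGen ρ (J ∩ K) (eval ρ smallWord)
    small-part = dihedral-part J K l1∈J l1∈K l2∉J small∈J small-letters
                   (λ q → subst (Walk (Owned (J ∩ K)) (ι q)) (f-onQ q) (moves (ι q)))
    large-part : InGen ρ (J ∩ K) (eval ρ largeWord)
    large-part = offQ-by-components (J ∩ K) (l2∉J ∘ p∩q⊆p J K) (eval ρ largeWord)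
                   (eval-injective ρ-injective largeWord) (largeWord-onQ large-letters)
                   (λ x off → subst (Walk (Owned (J ∩ K)) x) (f-offQ x off) (moves x))

  -- ⟨ρ_J⟩ ∩ ⟨ρ_K⟩ ⊆ ⟨ρ_{J∩K}⟩: by (1)-(3) unless 1 ∈ J ∩ K and 2 ∉ J ∩ K, which is
  -- the special case (with J and K exchanged if 2 ∈ J).
  intersection : ∀ J K f → InGen ρ J f → InGen ρ K f → InGen ρ (J ∩ K) f
  intersection J K f f∈J f∈K with l1 ∈? (J ∩ K) | l2 ∈? (J ∩ K)
  ... | _ | yes l2∈ = by-components (J ∩ K) (λ _ → l2∈) f (inGen-injective f∈J) (moves-∩ f∈J f∈K)
  ... | no l1∉ | no _ = by-components (J ∩ K) (⊥-elim ∘ l1∉) f (inGen-injective f∈J) (moves-∩ f∈J f∈K)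
  ... | yes l1∈ | no l2∉ with l2 ∈? J
  ...   | no l2∉J = special J K (p∩q⊆p J K l1∈) (p∩q⊆q J K l1∈) l2∉J f f∈J (moves-∩ f∈J f∈K)
  ...   | yes l2∈J = subst (λ L → InGen ρ L f) (∩-comm K J)
                       (special K J (p∩q⊆q J K l1∈) (p∩q⊆p J K l1∈) (λ l2∈K → l2∉ (x∈p∩q⁺ (l2∈J , l2∈K)))
                                f f∈K (moves-∩ f∈K f∈J))

-- The theorem; the argument above only needs n ≥ 5.
lemma6p2 : (n : ℕ) → 9 ≤ n → (ρ : Fin (n ∸ 2) → Fun n) → TypeA n ρ →
    ((π : Permutation′ n) → InGen ρ ⊤ (π ⟨$⟩ʳ_))
    × ((J K : Subset (n ∸ 2)) (f : Fun n) →
        ((InGen ρ J f × InGen ρ K f) → InGen ρ (J ∩ K) f)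
        × (InGen ρ (J ∩ K) f → InGen ρ J f × InGen ρ K f))
lemma6p2 _ (s≤s (s≤s (s≤s (s≤s (s≤s _))))) ρ A =
  generates ,
  λ J K f → (λ { (f∈J , f∈K) → intersection J K f f∈J f∈K }) ,
            (λ f∈J∩K → inGen-mono (p∩q⊆p J K) f∈J∩K , inGen-mono (p∩q⊆q J K) f∈J∩K)
  where
  open TypeAProof ρ A
  open Generated ρ
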